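{- Let $\mathcal{F} \subset \mathcal{P}([n])$ be an $r$-closed $\theta$-intersecting family, where $r \geq 3$ and $\theta \in (0,1)$. Let $A \in \mathcal{F}$ with $\mathrm{Tor}(A) \neq \emptyset$. Then $A \cap B = A \cap B'$ for all $B, B' \in \mathrm{Tor}(A)$.
   Context: A family $\mathcal{F} \subset \mathcal{P}([n])$ is $r$-closed $\theta$-intersecting if for each $2 \leq t \leq r$ and any $t$ distinct sets $A_1,\dots,A_t \in \mathcal{F}$ we have $|A_1 \cap \dots \cap A_t| \in \{\theta|A_1|, \dots, \theta|A_t|\}$. For $A \in \mathcal{F}$, $\mathrm{Tor}(A) := \{B \in \mathcal{F} : |B| \geq |A|,\ |A \cap B| = \theta|A|\}$.
   Formalization: The parameter θ is a rational number in the interval (0,1). -}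

module Defs where

open import Data.Nat using (ℕ; _≥_)
open import Data.Fin using (Fin)
open import Data.Fin.Subset using (Subset; _∩_; ∣_∣; ⊤)
open import Data.Vec using (Vec; foldr′; lookup)
open import Data.Integer using (+_)
open import Data.Rational using (ℚ; _*_; _/_)
open import Data.Product using (Σ; _×_; ∃)
open import Function.Definitions using (Injective)
open import Relation.Binary.PropositionalEquality using (_≡_)

ℕ→ℚ : ℕ → ℚ
ℕ→ℚ k = (+ k) / 1

Family : ℕ → Set₁
Family n = Subset n → Set

⋂ : ∀ {n t} → Vec (Subset n) t → Subset n
⋂ = foldr′ _∩_ ⊤

RClosedThetaIntersecting : ∀ {n} → ℕ → ℚ → Family n → Set
RClosedThetaIntersecting {n} r θ F =
  ∀ (t : ℕ) → 2 Data.Nat.≤ t → t Data.Nat.≤ r →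
  (As : Vec (Subset n) t) →
  (∀ i → F (lookup As i)) →
  Injective _≡_ _≡_ (lookup As) →
  Σ (Fin t) λ i → ℕ→ℚ ∣ ⋂ As ∣ ≡ θ * ℕ→ℚ ∣ lookup As i ∣

Tor : ∀ {n} → ℚ → Family n → Subset n → Subset n → Set
Tor θ F A B = F B × ∣ B ∣ ≥ ∣ A ∣ × ℕ→ℚ ∣ A ∩ B ∣ ≡ θ * ℕ→ℚ ∣ A ∣

{-# OPTIONS --safe #-}
-- If B ≠ B′ are both in Tor(A), apply the 3-intersection condition to A, B, B′:
-- |A ∩ B ∩ B′| equals θ times the size of one of them, hence is at least θ|A| = |A ∩ B|
-- since |B|, |B′| ≥ |A|. As A ∩ B ∩ B′ ⊆ A ∩ B, the two sets coincide, and likewise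
-- A ∩ B ∩ B′ = A ∩ B′. The degenerate case B = A forces |A| = θ|A|, so A = ∅.
module Submission where

open import Defs
open import Data.Nat using (ℕ; _≥_)
open import Data.Fin.Subset using (Subset; _∩_)
open import Data.Rational using (ℚ; 0ℚ; 1ℚ; _<_)
open import Data.Product using (∃)
open import Relation.Binary.PropositionalEquality using (_≡_)

open import Data.Bool using () renaming (_≟_ to _≟ᵇ_)
open import Data.Nat as ℕ using (zero; suc; z≤n; s≤s)
import Data.Nat.Properties as ℕ
open import Data.Nat.Coprimality using (1-coprimeTo)
import Data.Nat.Coprimality as Coprimality
open import Data.Integer as ℤ using (+_)
import Data.Integer.Properties as ℤ
open import Data.Rational as ℚ using (mkℚ; *≤*)
import Data.Rational.Properties as ℚ
open import Data.Fin.Subset using (_⊆_; ∣_∣; ⊥; inside; outside)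
open import Data.Fin.Subset.Properties
  using (p⊆q⇒∣p∣≤∣q∣; drop-∷-⊆; ⊥⊆; ∣⊥∣≡0; p∩q⊆p; ∩-idem; ∩-assoc; ∩-comm; ∩-identityʳ; ∩-zeroˡ)
open import Data.Vec using (Vec; []; _∷_; here; lookup)
open import Data.Vec.Properties using (≡-dec)
import Data.Vec.Relation.Unary.All.Properties as All
open import Data.Vec.Relation.Unary.All using ([]; _∷_)
open import Data.Vec.Relation.Unary.AllPairs using ([]; _∷_)
open import Data.Vec.Relation.Unary.Unique.Propositional.Properties using (lookup-injective)
open import Data.Product using (_,_)
open import Data.Empty using (⊥-elim)
open import Relation.Nullary using (yes; no)
open import Relation.Binary.Definitions using (DecidableEquality)
open import Function using (_∘_)
open import Relation.Binary.PropositionalEquality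
  using (_≢_; refl; sym; trans; cong; subst; subst₂; module ≡-Reasoning)

-- ℕ→ℚ is defined by normalisation, which does not compute on a variable numerator.
ℕ→ℚ≡mkℚ : ∀ k → ℕ→ℚ k ≡ mkℚ (+ k) 0 (Coprimality.sym (1-coprimeTo k))
ℕ→ℚ≡mkℚ k = ℚ.normalize-coprime (Coprimality.sym (1-coprimeTo k))

ℕ→ℚ-mono-≤ : ∀ {a b} → a ℕ.≤ b → ℕ→ℚ a ℚ.≤ ℕ→ℚ b
ℕ→ℚ-mono-≤ {a} {b} a≤b rewrite ℕ→ℚ≡mkℚ a | ℕ→ℚ≡mkℚ b =
  *≤* (subst₂ ℤ._≤_ (sym (ℤ.*-identityʳ (+ a))) (sym (ℤ.*-identityʳ (+ b))) (ℤ.+≤+ a≤b))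

ℕ→ℚ-cancel-≤ : ∀ {a b} → ℕ→ℚ a ℚ.≤ ℕ→ℚ b → a ℕ.≤ b
ℕ→ℚ-cancel-≤ {a} {b} a≤b rewrite ℕ→ℚ≡mkℚ a | ℕ→ℚ≡mkℚ b =
  ℤ.drop‿+≤+ (subst₂ ℤ._≤_ (ℤ.*-identityʳ (+ a)) (ℤ.*-identityʳ (+ b)) (ℚ.drop-*≤* a≤b))

p⊆q⇒∣q∣≤∣p∣⇒p≡q : ∀ {n} {p q : Subset n} → p ⊆ q → ∣ q ∣ ℕ.≤ ∣ p ∣ → p ≡ q
p⊆q⇒∣q∣≤∣p∣⇒p≡q {p = []}          {[]}          _   _ = refl
p⊆q⇒∣q∣≤∣p∣⇒p≡q {p = outside ∷ p} {outside ∷ q} p⊆q q≤p =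
  cong (outside ∷_) (p⊆q⇒∣q∣≤∣p∣⇒p≡q (drop-∷-⊆ p⊆q) q≤p)
p⊆q⇒∣q∣≤∣p∣⇒p≡q {p = outside ∷ p} {inside ∷ q}  p⊆q q≤p =
  ⊥-elim (ℕ.<-irrefl refl (ℕ.≤-trans q≤p (p⊆q⇒∣p∣≤∣q∣ (drop-∷-⊆ p⊆q))))
p⊆q⇒∣q∣≤∣p∣⇒p≡q {p = inside ∷ p}  {outside ∷ q} p⊆q _ with p⊆q here
... | ()
p⊆q⇒∣q∣≤∣p∣⇒p≡q {p = inside ∷ p}  {inside ∷ q}  p⊆q q≤p =
  cong (inside ∷_) (p⊆q⇒∣q∣≤∣p∣⇒p≡q (drop-∷-⊆ p⊆q) (ℕ.s≤s⁻¹ q≤p))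

∣p∣≡0⇒p≡⊥ : ∀ {n} {p : Subset n} → ∣ p ∣ ≡ 0 → p ≡ ⊥
∣p∣≡0⇒p≡⊥ {n} ∣p∣≡0 = sym (p⊆q⇒∣q∣≤∣p∣⇒p≡q ⊥⊆ (ℕ.≤-reflexive (trans ∣p∣≡0 (sym (∣⊥∣≡0 n)))))

_≟ˢ_ : ∀ {n} → DecidableEquality (Subset n)
_≟ˢ_ = ≡-dec _≟ᵇ_

p≡⊥⇒p∩q≡p∩r : ∀ {n} {p : Subset n} q r → p ≡ ⊥ → p ∩ q ≡ p ∩ r
p≡⊥⇒p∩q≡p∩r q r refl = trans (∩-zeroˡ q) (sym (∩-zeroˡ r))

⋂₃ : ∀ {n} (p q r : Subset n) → ⋂ (p ∷ q ∷ r ∷ []) ≡ p ∩ (q ∩ r)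
⋂₃ p q r = cong (λ s → p ∩ (q ∩ s)) (∩-identityʳ r)

θ-fixed⇒0 : ∀ {θ} → θ < 1ℚ → ∀ a → ℕ→ℚ a ≡ θ ℚ.* ℕ→ℚ a → a ≡ 0
θ-fixed⇒0 θ<1 zero    _ = refl
θ-fixed⇒0 θ<1 (suc k) a≡θa rewrite ℕ→ℚ≡mkℚ (suc k) =
  ⊥-elim (ℚ.<-irrefl refl (subst₂ _<_ (sym a≡θa) (ℚ.*-identityˡ _) (ℚ.*-monoˡ-<-pos _ θ<1)))

θ*-mono-≤ : ∀ {θ} → 0ℚ < θ → ∀ {a b} → a ℕ.≤ b → θ ℚ.* ℕ→ℚ a ℚ.≤ θ ℚ.* ℕ→ℚ b
θ*-mono-≤ {θ} 0<θ a≤b =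
  ℚ.*-monoˡ-≤-nonNeg θ {{ℚ.pos⇒nonNeg θ {{ℚ.positive 0<θ}}}} (ℕ→ℚ-mono-≤ a≤b)

∣A∩A∣≡θ∣A∣⇒A≡⊥ : ∀ {n θ} {A : Subset n} → θ < 1ℚ →
                 ℕ→ℚ ∣ A ∩ A ∣ ≡ θ ℚ.* ℕ→ℚ ∣ A ∣ → A ≡ ⊥
∣A∩A∣≡θ∣A∣⇒A≡⊥ {θ = θ} {A} θ<1 ∣A∩A∣≡θ∣A∣ =
  ∣p∣≡0⇒p≡⊥ (θ-fixed⇒0 θ<1 ∣ A ∣
    (subst (λ X → ℕ→ℚ ∣ X ∣ ≡ θ ℚ.* ℕ→ℚ ∣ A ∣) (∩-idem A) ∣A∩A∣≡θ∣A∣))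

module _ {n r θ} {F : Family n} (closed : RClosedThetaIntersecting r θ F)
         (r≥3 : r ≥ 3) (0<θ : 0ℚ < θ) where

  θ∣A∣≤∣A∩B∩C∣ : ∀ {A B C} → F A → F B → F C → A ≢ B → A ≢ C → B ≢ C →
                 ∣ A ∣ ℕ.≤ ∣ B ∣ → ∣ A ∣ ℕ.≤ ∣ C ∣ →
                 θ ℚ.* ℕ→ℚ ∣ A ∣ ℚ.≤ ℕ→ℚ ∣ A ∩ (B ∩ C) ∣
  θ∣A∣≤∣A∩B∩C∣ {A} {B} {C} FA FB FC A≢B A≢C B≢C A≤B A≤C
    with closed 3 (s≤s (s≤s z≤n)) r≥3 (A ∷ B ∷ C ∷ []) (All.lookup⁺ {P = F} (FA ∷ FB ∷ FC ∷ []))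
                (λ {i} {j} → lookup-injective ((A≢B ∷ A≢C ∷ []) ∷ (B≢C ∷ []) ∷ [] ∷ []) i j)
  ... | i , ∣⋂∣≡θ∣Xᵢ∣ = begin
    θ ℚ.* ℕ→ℚ ∣ A ∣        ≤⟨ θ*-mono-≤ 0<θ A≤Xᵢ ⟩
    θ ℚ.* ℕ→ℚ ∣ Xᵢ ∣       ≡⟨ sym ∣⋂∣≡θ∣Xᵢ∣ ⟩
    ℕ→ℚ ∣ ⋂ ABC ∣          ≡⟨ cong (λ X → ℕ→ℚ ∣ X ∣) (⋂₃ A B C) ⟩
    ℕ→ℚ ∣ A ∩ (B ∩ C) ∣    ∎
    where
    open ℚ.≤-Reasoning
    ABC : Vec (Subset n) 3
    ABC = A ∷ B ∷ C ∷ []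
    Xᵢ : Subset n
    Xᵢ = lookup ABC i
    A≤Xᵢ : ∣ A ∣ ℕ.≤ ∣ Xᵢ ∣
    A≤Xᵢ = All.lookup⁺ {P = λ X → ∣ A ∣ ℕ.≤ ∣ X ∣} (ℕ.≤-refl ∷ A≤B ∷ A≤C ∷ []) i

  Tor-distinct⇒∩-absorbs : ∀ {A B C} → F A → Tor θ F A B → Tor θ F A C →
                           A ≢ B → A ≢ C → B ≢ C → A ∩ (B ∩ C) ≡ A ∩ B
  Tor-distinct⇒∩-absorbs {A} {B} {C} FA (FB , A≤B , ∣A∩B∣≡θ∣A∣) (FC , A≤C , _) A≢B A≢C B≢C =
    p⊆q⇒∣q∣≤∣p∣⇒p≡q A∩B∩C⊆A∩B (ℕ→ℚ-cancel-≤ ∣A∩B∣≤∣A∩B∩C∣)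
    where
    A∩B∩C⊆A∩B : A ∩ (B ∩ C) ⊆ A ∩ B
    A∩B∩C⊆A∩B = subst (_⊆ A ∩ B) (∩-assoc A B C) (p∩q⊆p (A ∩ B) C)
    ∣A∩B∣≤∣A∩B∩C∣ : ℕ→ℚ ∣ A ∩ B ∣ ℚ.≤ ℕ→ℚ ∣ A ∩ (B ∩ C) ∣
    ∣A∩B∣≤∣A∩B∩C∣ = subst (ℚ._≤ _) (sym ∣A∩B∣≡θ∣A∣) (θ∣A∣≤∣A∩B∩C∣ FA FB FC A≢B A≢C B≢C A≤B A≤C)

  Tor-distinct⇒∩≡ : ∀ {A B B′} → F A → Tor θ F A B → Tor θ F A B′ →
                    A ≢ B → A ≢ B′ → B ≢ B′ → A ∩ B ≡ A ∩ B′
  Tor-distinct⇒∩≡ {A} {B} {B′} FA torB torB′ A≢B A≢B′ B≢B′ = begin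
    A ∩ B          ≡⟨ sym (Tor-distinct⇒∩-absorbs FA torB torB′ A≢B A≢B′ B≢B′) ⟩
    A ∩ (B ∩ B′)   ≡⟨ cong (A ∩_) (∩-comm B B′) ⟩
    A ∩ (B′ ∩ B)   ≡⟨ Tor-distinct⇒∩-absorbs FA torB′ torB A≢B′ A≢B (B≢B′ ∘ sym) ⟩
    A ∩ B′         ∎
    where open ≡-Reasoning

proposition2p3 : (n r : ℕ) (θ : ℚ) (F : Family n) →
    r ≥ 3 → 0ℚ < θ → θ < 1ℚ →
    RClosedThetaIntersecting r θ F →
    (A : Subset n) → F A →
    ∃ (λ B → Tor θ F A B) →
    ∀ B B′ → Tor θ F A B → Tor θ F A B′ → A ∩ B ≡ A ∩ B′
proposition2p3 n r θ F r≥3 0<θ θ<1 closed A FA _ B B′ torB@(_ , _ , ∣A∩B∣≡θ∣A∣) torB′@(_ , _ , ∣A∩B′∣≡θ∣A∣)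
  with B ≟ˢ B′ | A ≟ˢ B | A ≟ˢ B′
... | yes refl | _        | _        = refl
... | no _     | yes refl | _        = p≡⊥⇒p∩q≡p∩r _ _ (∣A∩A∣≡θ∣A∣⇒A≡⊥ θ<1 ∣A∩B∣≡θ∣A∣)
... | no _     | no _     | yes refl = p≡⊥⇒p∩q≡p∩r _ _ (∣A∩A∣≡θ∣A∣⇒A≡⊥ θ<1 ∣A∩B′∣≡θ∣A∣)
... | no B≢B′  | no A≢B   | no A≢B′  =
  Tor-distinct⇒∩≡ closed r≥3 0<θ FA torB torB′ A≢B A≢B′ B≢B′
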